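{- Let $\mathcal{M}^c=\langle S^c,N^c,V^c\rangle$ be the canonical model for $\mathbf{M}^\Delta$ and $(\mathcal{M}^c)^+=\langle S^c,(N^c)^+,V^c\rangle$ its supplementation. Then for all formulas $\phi\in\mathcal{L}(\Delta)$ and all $s\in S^c$: $(\mathcal{M}^c)^+,s\vDash\phi$ iff $\phi\in s$; i.e. $\phi^{(\mathcal{M}^c)^+}=|\phi|$.
   Context: $\mathcal{L}(\Delta)$: $\phi::=p\mid\neg\phi\mid\phi\land\phi\mid\Delta\phi$, $p$ in a countable set $\mathbf{P}$. Neighborhood semantics on $\langle S,N,V\rangle$: $\mathcal{M},s\vDash p$ iff $s\in V(p)$; Boolean clauses standard; $\mathcal{M},s\vDash\Delta\phi$ iff $\phi^{\mathcal{M}}\in N(s)$ or $S\setminus\phi^{\mathcal{M}}\in N(s)$, with $\phi^{\mathcal{M}}$ the truth set. $\mathbf{M}^\Delta$ is axiomatized by all propositional tautologies, $\Delta\phi\leftrightarrow\Delta\neg\phi$, $\Delta\phi\to\Delta(\phi\vee\psi)\vee\Delta(\neg\phi\vee\chi)$, modus ponens, and RE$\Delta$ (from $\phi\leftrightarrow\psi$ infer $\Delta\phi\leftrightarrow\Delta\psi$). Canonical model: $S^c$ = maximal $\mathbf{M}^\Delta$-consistent sets; $|\phi|=\{s\in S^c\mid\phi\in s\}$; $N^c(s)=\{|\phi|\mid\Delta(\phi\vee\psi)\in s\text{ for every formula }\psi\}$; $V^c(p)=|p|$. Supplementation: $(N^c)^+(s)=\{X\subseteq S^c\mid Y\subseteq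 X\text{ for some }Y\in N^c(s)\}$. -}

module Defs where

open import Level using (Level; Lift; lift; lower) renaming (suc to lsuc; zero to lzero)
open import Data.Nat using (ℕ)
open import Data.Bool using (Bool; true; false; not; _∧_)
open import Data.List using (List; []; _∷_)
open import Data.List.Relation.Unary.All using (All)
open import Data.Product using (Σ; _×_; _,_; ∃)
open import Data.Sum using (_⊎_)
open import Relation.Nullary using (¬_)
open import Relation.Binary.PropositionalEquality using (_≡_)

data Fm : Set where
  var  : ℕ → Fm
  ~_   : Fm → Fm
  _∧'_ : Fm → Fm → Fm
  Δ    : Fm → Fm

infixr 6 _∧'_
infixr 5 _∨'_
infixr 4 _⇒_ _⇔'_
infix 7 ~_
infix 2 ⊢_

_∨'_ : Fm → Fm → Fm
φ ∨' ψ = ~ (~ φ ∧' ~ ψ)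

_⇒_ : Fm → Fm → Fm
φ ⇒ ψ = ~ (φ ∧' ~ ψ)

_⇔'_ : Fm → Fm → Fm
φ ⇔' ψ = (φ ⇒ ψ) ∧' (ψ ⇒ φ)

⊤' : Fm
⊤' = ~ (var 0 ∧' ~ var 0)

evalB : (ℕ → Bool) → (Fm → Bool) → Fm → Bool
evalB v w (var n)  = v n
evalB v w (~ φ)    = not (evalB v w φ)
evalB v w (φ ∧' ψ) = evalB v w φ ∧ evalB v w ψ
evalB v w (Δ φ)    = w φ

Tautology : Fm → Set
Tautology φ = (v : ℕ → Bool) (w : Fm → Bool) → evalB v w φ ≡ true

data ⊢_ : Fm → Set where
  taut  : ∀ {φ} → Tautology φ → ⊢ φ
  ax-neg : ∀ φ → ⊢ (Δ φ ⇔' Δ (~ φ))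
  ax-M  : ∀ φ ψ χ → ⊢ (Δ φ ⇒ (Δ (φ ∨' ψ) ∨' Δ (~ φ ∨' χ)))
  mp    : ∀ {φ ψ} → ⊢ (φ ⇒ ψ) → ⊢ φ → ⊢ ψ
  reΔ   : ∀ {φ ψ} → ⊢ (φ ⇔' ψ) → ⊢ (Δ φ ⇔' Δ ψ)

FmSet : Set₁
FmSet = Fm → Set

conj : List Fm → Fm
conj []       = ⊤'
conj (φ ∷ L)  = φ ∧' conj L

Consistent : FmSet → Set
Consistent Γ = ¬ (Σ (List Fm) λ L → All Γ L × (⊢ ~ conj L))

_⨾_ : FmSet → Fm → FmSet
(Γ ⨾ φ) ψ = Γ ψ ⊎ (ψ ≡ φ)

MaxConsistent : FmSet → Set
MaxConsistent Γ = Consistent Γ × (∀ φ → ¬ Γ φ → ¬ Consistent (Γ ⨾ φ))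

record NbhdModel (ℓ : Level) : Set (lsuc ℓ) where
  field
    S : Set ℓ
    N : S → (S → Set ℓ) → Set ℓ
    V : ℕ → S → Set ℓ

module _ {ℓ : Level} (M : NbhdModel ℓ) where
  open NbhdModel M

  _,_⊨_ : S → Fm → Set ℓ
  _,_⊨_ s (var p)  = V p s
  _,_⊨_ s (~ φ)    = ¬ (_,_⊨_ s φ)
  _,_⊨_ s (φ ∧' ψ) = _,_⊨_ s φ × _,_⊨_ s ψ
  _,_⊨_ s (Δ φ)    = N s (λ t → _,_⊨_ t φ) ⊎ N s (λ t → ¬ (_,_⊨_ t φ))

Sc : Set₁
Sc = Σ FmSet MaxConsistent

_∈ₛ_ : Fm → Sc → Set
φ ∈ₛ (Γ , _) = Γ φ

-- truth set |φ|, lifted to Set₁ so that it is a subset of Sc at level 1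
∣_∣ : Fm → Sc → Set₁
∣ φ ∣ s = Lift (lsuc lzero) (φ ∈ₛ s)

_⊆ₛ_ : (Sc → Set₁) → (Sc → Set₁) → Set₁
X ⊆ₛ Y = ∀ s → X s → Y s

_≐_ : (Sc → Set₁) → (Sc → Set₁) → Set₁
X ≐ Y = X ⊆ₛ Y × Y ⊆ₛ X

Nc : Sc → (Sc → Set₁) → Set₁
Nc s X = Σ Fm λ φ → (X ≐ ∣ φ ∣) × (∀ ψ → Lift (lsuc lzero) (Δ (φ ∨' ψ) ∈ₛ s))

-- Supplementation: X ∈ (N^c)^+(s) iff Y ⊆ X for some Y ∈ N^c(s).
-- Every Y ∈ N^c(s) is (extensionally) some |φ|, so the existential over
-- the (large) collection of subsets Y is taken through its index φ;
-- this avoids an impredicative quantification over all subsets of Sc.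
Nc⁺ : Sc → (Sc → Set₁) → Set₁
Nc⁺ s X = Σ Fm λ φ → Nc s ∣ φ ∣ × (∣ φ ∣ ⊆ₛ X)

Vc : ℕ → Sc → Set₁
Vc p = ∣ var p ∣

Mc : NbhdModel (lsuc lzero)
Mc = record { S = Sc ; N = Nc ; V = Vc }

Mc⁺ : NbhdModel (lsuc lzero)
Mc⁺ = record { S = Sc ; N = Nc⁺ ; V = Vc }

-- A classical Lindenbaum construction shows that |χ| ⊆ |φ| in the canonical model forces
-- ⊢ χ → φ. The truth lemma then goes by induction on φ, the only real case being Δφ. If the
-- truth set of φ includes some |ψ| ∈ N^c(s), where |ψ| = |χ| with Δ(χ ∨ ·) ∈ s, then ⊢ χ → φ,
-- so Δ(χ ∨ φ) ↔ Δφ by RE and Δφ ∈ s; the complement case reduces to this by Δφ ↔ Δ¬φ.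
-- Conversely, if Δφ ∈ s then either Δ(φ ∨ ψ) ∈ s for all ψ, so |φ| ∈ N^c(s), or it fails
-- for some ψ and the axiom Δφ → Δ(φ ∨ ψ) ∨ Δ(¬φ ∨ χ) puts |¬φ| in N^c(s).
module Submission where

open import Defs
open import Level using (Lift; lift; lower) renaming (suc to lsuc; zero to lzero)
open import Axiom.ExcludedMiddle using (ExcludedMiddle)
open import Function.Base using (id; _∘_)
open import Function.Bundles using (_⇔_; mk⇔; Equivalence)
open import Data.Nat using (ℕ; zero; suc; _⊔_; _≤′_; ≤′-refl; ≤′-step)
open import Data.Nat.Properties using (≤⇒≤′; m≤m⊔n; m≤n⊔m)
open import Data.Fin using (Fin; zero; suc)
open import Data.Vec using (Vec; []; _∷_; lookup)
import Data.Vec as Vec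
open import Data.Vec.Properties using (lookup-map)
open import Data.Bool using (Bool; true; false; not; _∧_; T)
open import Data.Bool.Properties using (T-∧; T-≡)
open import Data.List using (List; []; _∷_; _++_; map; cartesianProductWith)
open import Data.List.Relation.Unary.All as All using (All; []; _∷_)
open import Data.List.Relation.Unary.Any using (here; there)
open import Data.List.Membership.Propositional using (_∈_)
open import Data.List.Membership.Propositional.Properties
  using (∈-map⁺; ∈-++⁺ˡ; ∈-++⁺ʳ; ∈-cartesianProductWith⁺)
open import Data.Product using (Σ; ∃; _×_; _,_; proj₁; proj₂)
open import Data.Sum using (_⊎_; inj₁; inj₂)
open import Data.Empty using (⊥-elim)
open import Relation.Nullary using (¬_; Dec; yes; no)
open import Relation.Nullary.Decidable using (map′; decidable-stable)
open import Relation.Binary.PropositionalEquality using (_≡_; refl; sym; trans; cong; cong₂)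

open Equivalence using (to; from)

private
  variable
    n : ℕ
    φ ψ χ θ : Fm
    Γ Θ Ξ : FmSet

-- Propositional reasoning is done by computation: a schema over n atoms whose truth table is
-- constantly true instantiates to a tautology, and the implicit truth-table certificate of
-- ⊢-tautology is solved by the typechecker.
data Schema (n : ℕ) : Set where
  atom : Fin n → Schema n
  ⊤ₛ   : Schema n
  ¬ₛ_  : Schema n → Schema n
  _∧ₛ_ : Schema n → Schema n → Schema n

infixr 6 _∧ₛ_
infixr 5 _∨ₛ_
infixr 4 _⇒ₛ_ _⇔ₛ_
infix 7 ¬ₛ_

_∨ₛ_ _⇒ₛ_ _⇔ₛ_ : Schema n → Schema n → Schema n
p ∨ₛ q = ¬ₛ (¬ₛ p ∧ₛ ¬ₛ q)
p ⇒ₛ q = ¬ₛ (p ∧ₛ ¬ₛ q)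
p ⇔ₛ q = (p ⇒ₛ q) ∧ₛ (q ⇒ₛ p)

p₀ : Schema (suc n)
p₀ = atom zero

p₁ : Schema (suc (suc n))
p₁ = atom (suc zero)

p₂ : Schema (suc (suc (suc n)))
p₂ = atom (suc (suc zero))

p₃ : Schema (suc (suc (suc (suc n))))
p₃ = atom (suc (suc (suc zero)))

⟦_⟧_ : Schema n → Vec Fm n → Fm
⟦ atom i ⟧ ρ = lookup ρ i
⟦ ⊤ₛ     ⟧ ρ = ⊤'
⟦ ¬ₛ p   ⟧ ρ = ~ ⟦ p ⟧ ρ
⟦ p ∧ₛ q ⟧ ρ = ⟦ p ⟧ ρ ∧' ⟦ q ⟧ ρ

evalₛ : Schema n → Vec Bool n → Bool
evalₛ (atom i) g = lookup g i
evalₛ ⊤ₛ       g = true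
evalₛ (¬ₛ p)   g = not (evalₛ p g)
evalₛ (p ∧ₛ q) g = evalₛ p g ∧ evalₛ q g

allTrue : ∀ n → (Vec Bool n → Bool) → Bool
allTrue zero    f = f []
allTrue (suc n) f = allTrue n (f ∘ (true ∷_)) ∧ allTrue n (f ∘ (false ∷_))

allTrue-sound : ∀ n f → T (allTrue n f) → ∀ g → T (f g)
allTrue-sound zero    f t []          = t
allTrue-sound (suc n) f t (true ∷ g)  = allTrue-sound n _ (proj₁ (to T-∧ t)) g
allTrue-sound (suc n) f t (false ∷ g) = allTrue-sound n _ (proj₂ (to T-∧ t)) g

evalB-⊤' : ∀ v w → evalB v w ⊤' ≡ true
evalB-⊤' v w with v 0
... | true  = refl
... | false = refl

evalB-⟦⟧ : ∀ v w (p : Schema n) ρ → evalB v w (⟦ p ⟧ ρ) ≡ evalₛ p (Vec.map (evalB v w) ρ)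
evalB-⟦⟧ v w (atom i) ρ = sym (lookup-map i (evalB v w) ρ)
evalB-⟦⟧ v w ⊤ₛ       ρ = evalB-⊤' v w
evalB-⟦⟧ v w (¬ₛ p)   ρ = cong not (evalB-⟦⟧ v w p ρ)
evalB-⟦⟧ v w (p ∧ₛ q) ρ = cong₂ _∧_ (evalB-⟦⟧ v w p ρ) (evalB-⟦⟧ v w q ρ)

⊢-tautology : (p : Schema n) (ρ : Vec Fm n) {_ : T (allTrue n (evalₛ p))} → ⊢ ⟦ p ⟧ ρ
⊢-tautology {n} p ρ {t} = taut λ v w →
  trans (evalB-⟦⟧ v w p ρ) (to T-≡ (allTrue-sound n (evalₛ p) t _))

mp₂ : ⊢ (φ ⇒ ψ ⇒ χ) → ⊢ φ → ⊢ ψ → ⊢ χ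
mp₂ h p q = mp (mp h p) q

⊢-⇔-to : ⊢ (φ ⇔' ψ) → ⊢ (φ ⇒ ψ)
⊢-⇔-to {φ} {ψ} = mp (⊢-tautology ((p₀ ⇔ₛ p₁) ⇒ₛ (p₀ ⇒ₛ p₁)) (φ ∷ ψ ∷ []))

⊢-⇔-from : ⊢ (φ ⇔' ψ) → ⊢ (ψ ⇒ φ)
⊢-⇔-from {φ} {ψ} = mp (⊢-tautology ((p₀ ⇔ₛ p₁) ⇒ₛ (p₁ ⇒ₛ p₀)) (φ ∷ ψ ∷ []))

Δ-absorb : ⊢ (χ ⇒ φ) → ⊢ (Δ (χ ∨' φ) ⇒ Δ φ)
Δ-absorb {χ} {φ} h =
  ⊢-⇔-to (reΔ (mp (⊢-tautology ((p₀ ⇒ₛ p₁) ⇒ₛ ((p₀ ∨ₛ p₁) ⇔ₛ p₁)) (χ ∷ φ ∷ [])) h))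

⊢-conj-copies : ∀ L → All (_≡ θ) L → ⊢ (θ ⇒ conj L)
⊢-conj-copies {θ} []      []           = ⊢-tautology (p₀ ⇒ₛ ⊤ₛ) (θ ∷ [])
⊢-conj-copies {θ} (_ ∷ L) (refl ∷ all) =
  mp (⊢-tautology ((p₀ ⇒ₛ p₁) ⇒ₛ (p₀ ⇒ₛ p₀ ∧ₛ p₁)) (θ ∷ conj L ∷ [])) (⊢-conj-copies L all)

_⊑_ : FmSet → FmSet → Set
Θ ⊑ Ξ = ∀ {φ} → Θ φ → Ξ φ

Consistent-antitone : Θ ⊑ Ξ → Consistent Ξ → Consistent Θ
Consistent-antitone Θ⊑Ξ con (L , all , ⊢¬L) = con (L , All.map Θ⊑Ξ all , ⊢¬L)

consistent-singleton : ¬ (⊢ ~ θ) → Consistent (_≡ θ)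
consistent-singleton {θ} ⊬¬θ (L , all , ⊢¬L) =
  ⊬¬θ (mp₂ (⊢-tautology ((p₀ ⇒ₛ p₁) ⇒ₛ ¬ₛ p₁ ⇒ₛ ¬ₛ p₀) (θ ∷ conj L ∷ [])) (⊢-conj-copies L all) ⊢¬L)

conj-⨾-split : ∀ L′ → All (Γ ⨾ φ) L′ → Σ (List Fm) λ L → All Γ L × (⊢ (conj L ∧' φ ⇒ conj L′))
conj-⨾-split {φ = φ} [] [] = [] , [] , ⊢-tautology (p₀ ⇒ₛ ⊤ₛ) (conj [] ∧' φ ∷ [])
conj-⨾-split {φ = φ} (ψ ∷ L′) (inj₁ ψ∈Γ ∷ all) with conj-⨾-split L′ all
... | L , allΓ , ⊢L′ = ψ ∷ L , ψ∈Γ ∷ allΓ ,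
  mp (⊢-tautology ((p₀ ∧ₛ p₁ ⇒ₛ p₂) ⇒ₛ (p₃ ∧ₛ p₀) ∧ₛ p₁ ⇒ₛ p₃ ∧ₛ p₂) (conj L ∷ φ ∷ conj L′ ∷ ψ ∷ [])) ⊢L′
conj-⨾-split {φ = φ} (ψ ∷ L′) (inj₂ refl ∷ all) with conj-⨾-split L′ all
... | L , allΓ , ⊢L′ = L , allΓ ,
  mp (⊢-tautology ((p₀ ∧ₛ p₁ ⇒ₛ p₂) ⇒ₛ p₀ ∧ₛ p₁ ⇒ₛ p₁ ∧ₛ p₂) (conj L ∷ φ ∷ conj L′ ∷ [])) ⊢L′

module Classical (lem : ExcludedMiddle (lsuc lzero)) where

  decide : (A : Set) → Dec A
  decide A = map′ lower lift lem

  dne : {A : Set} → ¬ ¬ A → A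
  dne = decidable-stable (decide _)

  module MaxConsistentSet (s : Sc) where
    private
      Γₛ : FmSet
      Γₛ = proj₁ s

      consistent : Consistent Γₛ
      consistent = proj₁ (proj₂ s)

      maximal : ∀ φ → ¬ Γₛ φ → ¬ Consistent (Γₛ ⨾ φ)
      maximal = proj₂ (proj₂ s)

    ∉⇒⊢¬ : ¬ φ ∈ₛ s → Σ (List Fm) λ L → All Γₛ L × (⊢ (conj L ⇒ ~ φ))
    ∉⇒⊢¬ {φ} φ∉ with dne (maximal φ φ∉)
    ... | L′ , all , ⊢¬L′ with conj-⨾-split L′ all
    ... | L , allΓ , ⊢L′ = L , allΓ ,
      mp₂ (⊢-tautology ((p₀ ∧ₛ p₁ ⇒ₛ p₂) ⇒ₛ ¬ₛ p₂ ⇒ₛ p₀ ⇒ₛ ¬ₛ p₁) (conj L ∷ φ ∷ conj L′ ∷ [])) ⊢L′ ⊢¬L′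

    ∈-closed₂ : φ ∈ₛ s → ψ ∈ₛ s → ⊢ (φ ∧' ψ ⇒ χ) → χ ∈ₛ s
    ∈-closed₂ {φ} {ψ} {χ} φ∈ ψ∈ ⊢φψχ = dne λ χ∉ →
      let L , all , ⊢¬χ = ∉⇒⊢¬ χ∉ in
      consistent (φ ∷ ψ ∷ L , φ∈ ∷ ψ∈ ∷ all ,
        mp₂ (⊢-tautology ((p₀ ∧ₛ p₁ ⇒ₛ p₂) ⇒ₛ (p₃ ⇒ₛ ¬ₛ p₂) ⇒ₛ ¬ₛ (p₀ ∧ₛ p₁ ∧ₛ p₃))
                         (φ ∷ ψ ∷ χ ∷ conj L ∷ []))
            ⊢φψχ ⊢¬χ)

    ∈-closed : φ ∈ₛ s → ⊢ (φ ⇒ ψ) → ψ ∈ₛ s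
    ∈-closed {φ} {ψ} φ∈ ⊢φψ =
      ∈-closed₂ φ∈ φ∈ (mp (⊢-tautology ((p₀ ⇒ₛ p₁) ⇒ₛ p₀ ∧ₛ p₀ ⇒ₛ p₁) (φ ∷ ψ ∷ [])) ⊢φψ)

    ⊤'-∈ : ⊤' ∈ₛ s
    ⊤'-∈ = dne λ ⊤∉ → let L , all , ⊢¬⊤ = ∉⇒⊢¬ ⊤∉ in
      consistent (L , all , mp (⊢-tautology ((p₀ ⇒ₛ ¬ₛ ⊤ₛ) ⇒ₛ ¬ₛ p₀) (conj L ∷ [])) ⊢¬⊤)

    ∧-∈ : φ ∈ₛ s → ψ ∈ₛ s → (φ ∧' ψ) ∈ₛ s
    ∧-∈ {φ} {ψ} φ∈ ψ∈ = ∈-closed₂ φ∈ ψ∈ (⊢-tautology (p₀ ∧ₛ p₁ ⇒ₛ p₀ ∧ₛ p₁) (φ ∷ ψ ∷ []))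

    ∧-∈ˡ : (φ ∧' ψ) ∈ₛ s → φ ∈ₛ s
    ∧-∈ˡ {φ} {ψ} φψ∈ = ∈-closed φψ∈ (⊢-tautology (p₀ ∧ₛ p₁ ⇒ₛ p₀) (φ ∷ ψ ∷ []))

    ∧-∈ʳ : (φ ∧' ψ) ∈ₛ s → ψ ∈ₛ s
    ∧-∈ʳ {φ} {ψ} φψ∈ = ∈-closed φψ∈ (⊢-tautology (p₀ ∧ₛ p₁ ⇒ₛ p₁) (φ ∷ ψ ∷ []))

    conj-∈ : ∀ {L} → All Γₛ L → conj L ∈ₛ s
    conj-∈ []          = ⊤'-∈
    conj-∈ (φ∈ ∷ all) = ∧-∈ φ∈ (conj-∈ all)

    ∉⇒~∈ : ¬ φ ∈ₛ s → (~ φ) ∈ₛ s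
    ∉⇒~∈ φ∉ = let L , all , ⊢¬φ = ∉⇒⊢¬ φ∉ in ∈-closed (conj-∈ all) ⊢¬φ

    ~∈⇒∉ : (~ φ) ∈ₛ s → ¬ φ ∈ₛ s
    ~∈⇒∉ {φ} ¬φ∈ φ∈ = consistent (φ ∷ ~ φ ∷ [] , φ∈ ∷ ¬φ∈ ∷ [] ,
      ⊢-tautology (¬ₛ (p₀ ∧ₛ ¬ₛ p₀ ∧ₛ ⊤ₛ)) (φ ∷ []))

    ∨-∈-resolve : (φ ∨' ψ) ∈ₛ s → ¬ φ ∈ₛ s → ψ ∈ₛ s
    ∨-∈-resolve {φ} {ψ} φψ∈ φ∉ =
      ∈-closed₂ φψ∈ (∉⇒~∈ φ∉) (⊢-tautology ((p₀ ∨ₛ p₁) ∧ₛ ¬ₛ p₀ ⇒ₛ p₁) (φ ∷ ψ ∷ []))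

  formulasUpTo : ℕ → List Fm
  formulasUpTo zero    = []
  formulasUpTo (suc n) = Fs ++ var n ∷ map ~_ Fs ++ map Δ Fs ++ cartesianProductWith _∧'_ Fs Fs
    where
      Fs : List Fm
      Fs = formulasUpTo n

  formulasUpTo-mono : ∀ {m n} → m ≤′ n → φ ∈ formulasUpTo m → φ ∈ formulasUpTo n
  formulasUpTo-mono ≤′-refl        φ∈ = φ∈
  formulasUpTo-mono (≤′-step m≤′n) φ∈ = ∈-++⁺ˡ (formulasUpTo-mono m≤′n φ∈)

  formulasUpTo-complete : ∀ φ → ∃ λ n → φ ∈ formulasUpTo n
  formulasUpTo-complete (var k) = suc k , ∈-++⁺ʳ (formulasUpTo k) (here refl)
  formulasUpTo-complete (~ φ) with formulasUpTo-complete φ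
  ... | n , φ∈ = suc n , ∈-++⁺ʳ (formulasUpTo n) (there (∈-++⁺ˡ (∈-map⁺ ~_ φ∈)))
  formulasUpTo-complete (Δ φ) with formulasUpTo-complete φ
  ... | n , φ∈ = suc n , ∈-++⁺ʳ (formulasUpTo n)
    (there (∈-++⁺ʳ (map ~_ (formulasUpTo n)) (∈-++⁺ˡ (∈-map⁺ Δ φ∈))))
  formulasUpTo-complete (φ ∧' ψ) with formulasUpTo-complete φ | formulasUpTo-complete ψ
  ... | m , φ∈ | n , ψ∈ = suc (m ⊔ n) , ∈-++⁺ʳ (formulasUpTo (m ⊔ n))
    (there (∈-++⁺ʳ (map ~_ (formulasUpTo (m ⊔ n))) (∈-++⁺ʳ (map Δ (formulasUpTo (m ⊔ n)))
      (∈-cartesianProductWith⁺ _∧'_ (formulasUpTo-mono (≤⇒≤′ (m≤m⊔n m n)) φ∈)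
                                    (formulasUpTo-mono (≤⇒≤′ (m≤n⊔m m n)) ψ∈)))))

  extendIf : (Γ : FmSet) (φ : Fm) → Dec (Consistent (Γ ⨾ φ)) → FmSet
  extendIf Γ φ (yes _) = Γ ⨾ φ
  extendIf Γ φ (no _)  = Γ

  extend : FmSet → Fm → FmSet
  extend Γ φ = extendIf Γ φ (decide _)

  extendIf-⊒ : ∀ d → Γ ⊑ extendIf Γ φ d
  extendIf-⊒ (yes _) = inj₁
  extendIf-⊒ (no _)  = id

  extendIf-consistent : ∀ d → Consistent Γ → Consistent (extendIf Γ φ d)
  extendIf-consistent (yes con) _   = con
  extendIf-consistent (no _)    con = con

  extendIf-∋ : ∀ d → Consistent (Γ ⨾ φ) → extendIf Γ φ d φ
  extendIf-∋ (yes _)  _   = inj₂ refl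
  extendIf-∋ (no ¬con) con = ⊥-elim (¬con con)

  extendAll : FmSet → List Fm → FmSet
  extendAll Γ []      = Γ
  extendAll Γ (φ ∷ L) = extendAll (extend Γ φ) L

  extendAll-⊒ : ∀ L → Γ ⊑ extendAll Γ L
  extendAll-⊒ []      = id
  extendAll-⊒ (φ ∷ L) = extendAll-⊒ L ∘ extendIf-⊒ (decide _)

  extendAll-consistent : ∀ L → Consistent Γ → Consistent (extendAll Γ L)
  extendAll-consistent []      con = con
  extendAll-consistent (φ ∷ L) con = extendAll-consistent L (extendIf-consistent (decide _) con)

  extendAll-decides : ∀ Γ L → φ ∈ L →
    Σ FmSet λ Θ → Θ ⊑ extendAll Γ L × (Consistent (Θ ⨾ φ) → extendAll Γ L φ)
  extendAll-decides Γ (φ ∷ L) (here refl) =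
    Γ , extendAll-⊒ L ∘ extendIf-⊒ (decide _) , extendAll-⊒ L ∘ extendIf-∋ (decide _)
  extendAll-decides Γ (ψ ∷ L) (there φ∈) = extendAll-decides (extend Γ ψ) L φ∈

  module Lindenbaum (Γ₀ : FmSet) (con₀ : Consistent Γ₀) where

    stage : ℕ → FmSet
    stage zero    = Γ₀
    stage (suc n) = extendAll (stage n) (formulasUpTo n)

    stage-mono : ∀ {m n} → m ≤′ n → stage m ⊑ stage n
    stage-mono ≤′-refl                    = id
    stage-mono {n = suc n} (≤′-step m≤′n) = extendAll-⊒ (formulasUpTo n) ∘ stage-mono m≤′n

    stage-consistent : ∀ n → Consistent (stage n)
    stage-consistent zero    = con₀
    stage-consistent (suc n) = extendAll-consistent (formulasUpTo n) (stage-consistent n)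

    limit : FmSet
    limit φ = ∃ λ n → stage n φ

    limit-finite : ∀ {L} → All limit L → ∃ λ n → All (stage n) L
    limit-finite []                 = 0 , []
    limit-finite ((m , φ∈) ∷ all) with limit-finite all
    ... | n , allₙ = m ⊔ n , stage-mono (≤⇒≤′ (m≤m⊔n m n)) φ∈
                           ∷ All.map (stage-mono (≤⇒≤′ (m≤n⊔m m n))) allₙ

    limit-consistent : Consistent limit
    limit-consistent (L , all , ⊢¬L) with limit-finite all
    ... | n , allₙ = stage-consistent n (L , allₙ , ⊢¬L)

    limit-maximal : ∀ φ → ¬ limit φ → ¬ Consistent (limit ⨾ φ)
    limit-maximal φ φ∉ con with formulasUpTo-complete φ
    ... | n , φ∈ with extendAll-decides (stage n) (formulasUpTo n) φ∈
    ... | Θ , Θ⊑ , decided = φ∉ (suc n , decided (Consistent-antitone Θ⨾φ⊑ con))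
      where
        Θ⨾φ⊑ : (Θ ⨾ φ) ⊑ (limit ⨾ φ)
        Θ⨾φ⊑ (inj₁ ψ∈) = inj₁ (suc n , Θ⊑ ψ∈)
        Θ⨾φ⊑ (inj₂ eq) = inj₂ eq

  lindenbaum : Consistent Γ → Σ Sc λ s → Γ ⊑ proj₁ s
  lindenbaum {Γ} con = (limit , limit-consistent , limit-maximal) , (0 ,_)
    where open Lindenbaum Γ con

  open MaxConsistentSet

  ∣⊆∣⇒⊢ : ∣ χ ∣ ⊆ₛ ∣ φ ∣ → ⊢ (χ ⇒ φ)
  ∣⊆∣⇒⊢ {χ} {φ} ∣χ∣⊆∣φ∣ = dne λ ⊬χ⇒φ →
    let s , θ∈ = lindenbaum (consistent-singleton ⊬χ⇒φ) in
    ~∈⇒∉ s (∧-∈ʳ s (θ∈ refl)) (lower (∣χ∣⊆∣φ∣ s (lift (∧-∈ˡ s (θ∈ refl)))))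

  Nc⁺-⊆⇒Δ∈ : ∀ s {X} → Nc⁺ s X → X ⊆ₛ ∣ φ ∣ → Δ φ ∈ₛ s
  Nc⁺-⊆⇒Δ∈ {φ} s (ψ , (χ , (_ , ∣χ∣⊆∣ψ∣) , Δχ∨-∈) , ∣ψ∣⊆X) X⊆∣φ∣ =
    ∈-closed s (lower (Δχ∨-∈ φ)) (Δ-absorb (∣⊆∣⇒⊢ λ t → X⊆∣φ∣ t ∘ ∣ψ∣⊆X t ∘ ∣χ∣⊆∣ψ∣ t))

  Δ∈⇒Nc : ∀ s → Δ φ ∈ₛ s → Nc s ∣ φ ∣ ⊎ Nc s ∣ ~ φ ∣
  Δ∈⇒Nc {φ} s Δφ∈ with decide (∀ ψ → Δ (φ ∨' ψ) ∈ₛ s)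
  ... | yes Δφ∨-∈ = inj₁ (φ , ((λ _ → id) , (λ _ → id)) , lift ∘ Δφ∨-∈)
  ... | no ¬Δφ∨-∈ = inj₂ (~ φ , ((λ _ → id) , (λ _ → id)) , lift ∘ Δ¬φ∨-∈)
    where
      Δ¬φ∨-∈ : ∀ χ → Δ (~ φ ∨' χ) ∈ₛ s
      Δ¬φ∨-∈ χ = dne λ Δ¬φ∨χ∉ → ¬Δφ∨-∈ λ ψ → dne λ Δφ∨ψ∉ →
        Δ¬φ∨χ∉ (∨-∈-resolve s (∈-closed s Δφ∈ (ax-M φ ψ χ)) Δφ∨ψ∉)

  Δ-truth : ∀ s {X} → X ≐ ∣ φ ∣ → (Nc⁺ s X ⊎ Nc⁺ s (λ t → ¬ X t)) ⇔ Lift (lsuc lzero) (Δ φ ∈ₛ s)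
  Δ-truth {φ} s {X} (X⊆∣φ∣ , ∣φ∣⊆X) = mk⇔ sound complete
    where
      ¬X⊆∣~φ∣ : (λ t → ¬ X t) ⊆ₛ ∣ ~ φ ∣
      ¬X⊆∣~φ∣ t ¬Xt = lift (∉⇒~∈ t (¬Xt ∘ ∣φ∣⊆X t ∘ lift))

      sound : Nc⁺ s X ⊎ Nc⁺ s (λ t → ¬ X t) → Lift (lsuc lzero) (Δ φ ∈ₛ s)
      sound (inj₁ N⁺X)  = lift (Nc⁺-⊆⇒Δ∈ s N⁺X X⊆∣φ∣)
      sound (inj₂ N⁺¬X) = lift (∈-closed s (Nc⁺-⊆⇒Δ∈ s N⁺¬X ¬X⊆∣~φ∣) (⊢-⇔-from (ax-neg φ)))

      complete : Lift (lsuc lzero) (Δ φ ∈ₛ s) → Nc⁺ s X ⊎ Nc⁺ s (λ t → ¬ X t)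
      complete (lift Δφ∈) with Δ∈⇒Nc s Δφ∈
      ... | inj₁ N∣φ∣  = inj₁ (φ , N∣φ∣ , ∣φ∣⊆X)
      ... | inj₂ N∣~φ∣ = inj₂ (~ φ , N∣~φ∣ , λ t ~φ∈ Xt → ~∈⇒∉ t (lower ~φ∈) (lower (X⊆∣φ∣ t Xt)))

  truth-lemma : ∀ φ s → (Mc⁺ , s ⊨ φ) ⇔ Lift (lsuc lzero) (φ ∈ₛ s)
  truth-lemma (var p)  s = mk⇔ id id
  truth-lemma (~ φ)    s = mk⇔
    (λ ⊭φ → lift (∉⇒~∈ s (⊭φ ∘ from (truth-lemma φ s) ∘ lift)))
    (λ ~φ∈ → ~∈⇒∉ s (lower ~φ∈) ∘ lower ∘ to (truth-lemma φ s))
  truth-lemma (φ ∧' ψ) s = mk⇔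
    (λ (⊨φ , ⊨ψ) → lift (∧-∈ s (lower (to (truth-lemma φ s) ⊨φ)) (lower (to (truth-lemma ψ s) ⊨ψ))))
    (λ φψ∈ → from (truth-lemma φ s) (lift (∧-∈ˡ s (lower φψ∈)))
           , from (truth-lemma ψ s) (lift (∧-∈ʳ s (lower φψ∈))))
  truth-lemma (Δ φ)    s = Δ-truth s ((λ t → to (truth-lemma φ t)) , (λ t → from (truth-lemma φ t)))

mainTheorem13 : ExcludedMiddle (lsuc lzero) →
    (φ : Fm) (s : Sc) → (Mc⁺ , s ⊨ φ) ⇔ Lift (lsuc lzero) (φ ∈ₛ s)
mainTheorem13 lem = Classical.truth-lemma lem
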